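{- Let $n,s,\ell,c$ be positive integers with $n=2s+c=3s-\ell$ and $c,\ell\in\{1,\dots,s-1\}$, and let $d\ge 0$ be even. If $\mathcal{F}\subset 2^{[n]}$ is a shifted family with $d(\mathcal{F})\le d$, then $$y_{\mathcal{F}}(2)\ge\min\Big\{\frac{(4\ell+3c+d-2)(3c-d+1)}{2},\ \frac{(\ell+3c-\frac d2+1)(\ell+3c-\frac d2)}{2}\Big\}.$$ Moreover, equality is achieved only if $\mathcal{F}^{(2)}=\binom{[2\ell+d-1]}{2}$ or $\mathcal{F}^{(2)}=\{F\in\binom{[n]}{2}: F\cap[\ell+\frac d2-1]\neq\emptyset\}$.
   Context: $[m]=\{1,\dots,m\}$, $[a,b]=\{a,\dots,b\}$. $\mathcal{F}^{(i)}=\mathcal{F}\cap\binom{[n]}{i}$ and $y_{\mathcal{F}}(i)=\binom{n}{i}-|\mathcal{F}^{(i)}|$. Shifts: for $a<b$, $S_{a\leftarrow b}(A)=(A\setminus\{b\})\cup\{a\}$ if $b\in A,a\notin A$, else $A$; $S_{a\leftarrow b}(\mathcal{F})=\{S_{a\leftarrow b}(A):A\in\mathcal{F}\}\cup\{A\in\mathcal{F}:S_{a\leftarrow b}(A)\in\mathcal{F}\}$; $\mathcal{F}$ is shifted if $S_{a\leftarrow b}(\mathcal{F})=\mathcal{F}$ for all $a<b$. $d(\mathcal{F})$ is the smallest integer $d\ge 0$ such that either ($d$ is even and for some $i\in[1,\ell+\frac d2]$ the set $\{i,2\ell+d+1-i\}\notin\mathcal{F}$) or ($d$ is odd and either $\{1,2\ell+d\}\notin\mathcal{F}$,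 or for some $i\in[3,\ell+\frac{d+1}{2}]$ the set $\{i,2\ell+d+2-i\}\notin\mathcal{F}$). -}

module Defs where

open import Data.Nat as ℕ using (ℕ; zero; suc; _+_; _*_; _∸_; _≤_; _<_; _/_)
open import Data.Nat.Divisibility using (_∣_)
open import Data.Bool using (Bool; true; false; _∧_; not; if_then_else_)
open import Data.Fin using (Fin; toℕ)
open import Data.Fin.Subset using (Subset; inside; outside; _∈_; ⁅_⁆; _∪_; ∣_∣)
open import Data.Vec using (Vec; []; _∷_; lookup; _[_]≔_)
open import Data.List using (List; []; _∷_; map; _++_)
open import Data.Product using (Σ; ∃; _×_)
open import Data.Sum using (_⊎_)
open import Relation.Binary.PropositionalEquality using (_≡_)
open import Relation.Nullary using (¬_)

-- A family 𝓕 ⊆ 2^[n] : a (decidable) membership predicate on subsets of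
-- the ground set Fin n.  Element x : Fin n stands for the integer toℕ x + 1 ∈ [n].
Family : ℕ → Set
Family n = Subset n → Bool

allSubsets : (n : ℕ) → List (Subset n)
allSubsets zero = [] ∷ []
allSubsets (suc n) = map (outside ∷_) (allSubsets n) ++ map (inside ∷_) (allSubsets n)

countᵇ : {A : Set} → (A → Bool) → List A → ℕ
countᵇ p [] = 0
countᵇ p (x ∷ xs) = if p x then suc (countᵇ p xs) else countᵇ p xs

-- y_𝓕(2) = C(n,2) - |𝓕^(2)| = number of 2-subsets of [n] not in 𝓕
y2 : {n : ℕ} → Family n → ℕ
y2 {n} F = countᵇ (λ A → (∣ A ∣ ℕ.≡ᵇ 2) ∧ not (F A)) (allSubsets n)

shiftSet : {n : ℕ} → Fin n → Fin n → Subset n → Subset n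
shiftSet a b A =
  if lookup A b ∧ not (lookup A a)
  then (A [ b ]≔ outside) [ a ]≔ inside
  else A

InShiftFam : {n : ℕ} → Fin n → Fin n → Family n → Subset n → Set
InShiftFam a b F X =
  (Σ (Subset _) λ A → F A ≡ true × shiftSet a b A ≡ X)
  ⊎ (F X ≡ true × F (shiftSet a b X) ≡ true)

Shifted : {n : ℕ} → Family n → Set
Shifted {n} F = (a b : Fin n) → toℕ a < toℕ b → (X : Subset n) →
  (InShiftFam a b F X → F X ≡ true) × (F X ≡ true → InShiftFam a b F X)

-- the 2-set {i,j} (i, j given as integers, 1-indexed) belongs to 𝓕;
-- false whenever i or j lies outside [n]
PairIn : {n : ℕ} → Family n → ℕ → ℕ → Set
PairIn {n} F i j = Σ (Fin n) λ x → Σ (Fin n) λ y →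
  (suc (toℕ x) ≡ i) × (suc (toℕ y) ≡ j) × (F (⁅ x ⁆ ∪ ⁅ y ⁆) ≡ true)

DCond : {n : ℕ} → ℕ → Family n → ℕ → Set
DCond ℓ F m =
  ((2 ∣ m) × (∃ λ i → (1 ≤ i) × (i ≤ ℓ + m / 2) × ¬ PairIn F i (2 * ℓ + m + 1 ∸ i)))
  ⊎ ((¬ (2 ∣ m)) ×
     ((¬ PairIn F 1 (2 * ℓ + m))
      ⊎ (∃ λ i → (3 ≤ i) × (i ≤ ℓ + (m + 1) / 2) × ¬ PairIn F i (2 * ℓ + m + 2 ∸ i))))

IsD : {n : ℕ} → ℕ → Family n → ℕ → Set
IsD ℓ F m = DCond ℓ F m × ((m' : ℕ) → m' < m → ¬ DCond ℓ F m')

SubsetOfInit : {n : ℕ} → Subset n → ℕ → Set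
SubsetOfInit {n} A m = (x : Fin n) → x ∈ A → suc (toℕ x) ≤ m

MeetsInit : {n : ℕ} → Subset n → ℕ → Set
MeetsInit {n} A m = Σ (Fin n) λ x → x ∈ A × suc (toℕ x) ≤ m

{-# OPTIONS --safe #-}
-- Write n = 2ℓ + 3c and d = 2t. The condition d(𝓕) ≤ d yields a pair {i < j} ∉ 𝓕 with
-- i + j ≤ 2(ℓ + t) + 1, and since 𝓕 is shifted every pair {x < y} with x ≥ i and
-- y ≥ 2(ℓ + t) + 1 − i is missing as well. Writing i = a + 1 and a + b + 1 = ℓ + t,
-- these "upper pairs" number k(k + 4b + 1)/2 with k = n − a − 2b − 1. For fixed a + b
-- this is a concave quadratic in a, so it is smallest at a = 0 or b = 0, which are the
-- two terms of the bound, and strictly larger in between. In the equality case 𝓕⁽²⁾ is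
-- therefore the complement of the upper pairs for a = 0 or b = 0: the two extremal
-- families. When d > 3c the bound is at most 0 and only y(2) = 0 has to be examined.
module Submission where

open import Defs
open import Data.Bool using (Bool; true; false; _∧_; _∨_; not)
open import Data.Bool.Properties
  using (∧-conicalˡ; ∧-conicalʳ; ∧-identityʳ; ∨-zeroʳ; not-injective; ¬-not; not-¬; T-≡)
open import Data.Fin using (Fin; toℕ; fromℕ<) renaming (zero to fzero; suc to fsuc)
open import Data.Fin.Properties using (toℕ-injective; toℕ<n; toℕ-fromℕ<) renaming (_≟_ to _≟ᶠ_; <⇒≢ to <⇒≢ᶠ)
open import Data.Fin.Subset using (Subset; inside; outside; ⁅_⁆; _∪_; ∣_∣; ⊥; _∈_)
open import Data.Fin.Subset.Properties using (x∈⁅x⁆; x∈⁅y⁆⇒x≡y; x∈p∪q⁻; x∈p∪q⁺; ∪-comm; ∪-identityˡ)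
open import Data.Integer as ℤ using (ℤ; +_; _-_; _⊓_; 0ℤ; +≤+)
import Data.Integer.Properties as ℤₚ
open import Data.List using (List; []; _∷_; map; _++_)
open import Data.List.Membership.Propositional using () renaming (_∈_ to _∈ˡ_)
open import Data.List.Membership.Propositional.Properties using (∈-++⁺ˡ; ∈-++⁺ʳ; ∈-map⁺)
open import Data.List.Relation.Unary.Any using (here; there)
open import Data.Nat as ℕ using (ℕ; zero; suc; _+_; _*_; _∸_; _≤_; _<_; _/_; z≤n; s≤s; s≤s⁻¹; _≡ᵇ_)
open import Data.Nat.Properties
open import Data.Nat.DivMod using (m*n/n≡m)
open import Data.Nat.Divisibility using (_∣_; divides)
open import Data.Nat.Tactic.RingSolver using (solve-∀)
open import Data.Product using (∃; ∃₂; _×_; _,_; proj₁; proj₂)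
open import Data.Sum using (_⊎_; inj₁; inj₂)
import Data.Sum as Sum
open import Data.Vec using (Vec; []; _∷_; lookup; _[_]≔_; here; there)
open import Data.Vec.Properties
  using (lookup∘update; lookup∘update′; []=⇒lookup; lookup⇒[]=; lookup-zipWith; tabulate∘lookup; tabulate-cong)
open import Function using (_∘_; Equivalence)
open import Relation.Binary.PropositionalEquality
open import Relation.Nullary using (¬_; yes; no; contradiction)

infix 4 _⇒ᵇ_

_⇒ᵇ_ : {A : Set} → (A → Bool) → (A → Bool) → Set
p ⇒ᵇ q = ∀ x → p x ≡ true → q x ≡ true

∧-true : ∀ {x y} → x ≡ true → y ≡ true → x ∧ y ≡ true
∧-true refl refl = refl

module _ {A : Set} where

  countᵇ-++ : (p : A → Bool) (xs ys : List A) → countᵇ p (xs ++ ys) ≡ countᵇ p xs + countᵇ p ys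
  countᵇ-++ p []       ys = refl
  countᵇ-++ p (x ∷ xs) ys with p x
  ... | true  = cong suc (countᵇ-++ p xs ys)
  ... | false = countᵇ-++ p xs ys

  countᵇ-cong : {p q : A → Bool} → (∀ x → p x ≡ q x) → (xs : List A) → countᵇ p xs ≡ countᵇ q xs
  countᵇ-cong p≗q []       = refl
  countᵇ-cong {q = q} p≗q (x ∷ xs) rewrite p≗q x with q x
  ... | true  = cong suc (countᵇ-cong p≗q xs)
  ... | false = countᵇ-cong p≗q xs

  countᵇ-false : (xs : List A) → countᵇ (λ _ → false) xs ≡ 0
  countᵇ-false []       = refl
  countᵇ-false (_ ∷ xs) = countᵇ-false xs

  countᵇ≡0⇒false : (p : A → Bool) (xs : List A) → countᵇ p xs ≡ 0 → ∀ {x} → x ∈ˡ xs → p x ≡ false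
  countᵇ≡0⇒false p (y ∷ xs) eq x∈ with p y in py
  countᵇ≡0⇒false p (y ∷ xs) eq (here refl) | false = py
  countᵇ≡0⇒false p (y ∷ xs) eq (there x∈) | false = countᵇ≡0⇒false p xs eq x∈

  countᵇ-mono : {p q : A → Bool} → p ⇒ᵇ q → (xs : List A) → countᵇ p xs ≤ countᵇ q xs
  countᵇ-mono p⇒q [] = z≤n
  countᵇ-mono {p} {q} p⇒q (x ∷ xs) with p x in px | q x in qx
  ... | true  | true  = s≤s (countᵇ-mono p⇒q xs)
  ... | true  | false = contradiction (trans (sym (p⇒q x px)) qx) λ ()
  ... | false | true  = m≤n⇒m≤1+n (countᵇ-mono p⇒q xs)
  ... | false | false = countᵇ-mono p⇒q xs

  countᵇ-mono-≡ : {p q : A → Bool} → p ⇒ᵇ q → (xs : List A) → countᵇ p xs ≡ countᵇ q xs →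
                  ∀ {x} → x ∈ˡ xs → q x ≡ true → p x ≡ true
  countᵇ-mono-≡ {p} {q} p⇒q (y ∷ xs) eq x∈ qx with p y in py | q y in qy
  countᵇ-mono-≡ p⇒q (y ∷ xs) eq (here refl) qx | true  | _     = py
  countᵇ-mono-≡ p⇒q (y ∷ xs) eq (here refl) qx | false | false = contradiction (trans (sym qx) qy) λ ()
  countᵇ-mono-≡ p⇒q (y ∷ xs) eq (there x∈)  qx | true  | true  = countᵇ-mono-≡ p⇒q xs (suc-injective eq) x∈ qx
  countᵇ-mono-≡ p⇒q (y ∷ xs) eq (there x∈)  qx | false | false = countᵇ-mono-≡ p⇒q xs eq x∈ qx
  countᵇ-mono-≡ p⇒q (y ∷ xs) eq _ _ | true  | false = contradiction (trans (sym (p⇒q y py)) qy) λ ()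
  countᵇ-mono-≡ p⇒q (y ∷ xs) eq _ _ | false | true  = contradiction eq (<⇒≢ (s≤s (countᵇ-mono p⇒q xs)))

countᵇ-map : {A B : Set} (p : B → Bool) (f : A → B) (xs : List A) → countᵇ p (map f xs) ≡ countᵇ (p ∘ f) xs
countᵇ-map p f []       = refl
countᵇ-map p f (x ∷ xs) with p (f x)
... | true  = cong suc (countᵇ-map p f xs)
... | false = countᵇ-map p f xs

countᵇ-allSubsets-suc : ∀ N (p : Subset (suc N) → Bool) →
  countᵇ p (allSubsets (suc N)) ≡
  countᵇ (λ A → p (outside ∷ A)) (allSubsets N) + countᵇ (λ A → p (inside ∷ A)) (allSubsets N)
countᵇ-allSubsets-suc N p =
  trans (countᵇ-++ p (map (outside ∷_) (allSubsets N)) (map (inside ∷_) (allSubsets N)))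
        (cong₂ _+_ (countᵇ-map p (outside ∷_) (allSubsets N)) (countᵇ-map p (inside ∷_) (allSubsets N)))

∈-allSubsets : ∀ {N} (A : Subset N) → A ∈ˡ allSubsets N
∈-allSubsets []                    = here refl
∈-allSubsets {suc N} (outside ∷ A) = ∈-++⁺ˡ (∈-map⁺ (outside ∷_) (∈-allSubsets A))
∈-allSubsets {suc N} (inside ∷ A)  =
  ∈-++⁺ʳ (map (outside ∷_) (allSubsets N)) (∈-map⁺ (inside ∷_) (∈-allSubsets A))

-- Ground elements are 0-indexed here (x : Fin n is x itself), whereas PairIn is 1-indexed.
nonempty : ∀ {n} → Subset n → Bool
nonempty []      = false
nonempty (x ∷ A) = x ∨ nonempty A

meetsFrom : ∀ {n} → ℕ → Subset n → Bool
meetsFrom zero    A       = nonempty A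
meetsFrom (suc q) []      = false
meetsFrom (suc q) (_ ∷ A) = meetsFrom q A

avoidsBelow : ∀ {n} → ℕ → Subset n → Bool
avoidsBelow zero    _       = true
avoidsBelow (suc p) []      = true
avoidsBelow (suc p) (x ∷ A) = not x ∧ avoidsBelow p A

isPair : ∀ {n} → Subset n → Bool
isPair A = ∣ A ∣ ≡ᵇ 2

upperPair : ∀ {n} → ℕ → ℕ → Subset n → Bool
upperPair p q A = avoidsBelow p A ∧ (isPair A ∧ meetsFrom q A)

missing : ∀ {n} → Family n → Subset n → Bool
missing F A = isPair A ∧ not (F A)

nonempty⁺ : ∀ {n} (A : Subset n) {z} → z ∈ A → nonempty A ≡ true
nonempty⁺ (inside ∷ A) here        = refl
nonempty⁺ (x ∷ A)      (there z∈A) = trans (cong (x ∨_) (nonempty⁺ A z∈A)) (∨-zeroʳ x)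

nonempty⁻ : ∀ {n} (A : Subset n) → nonempty A ≡ true → ∃ λ z → z ∈ A
nonempty⁻ (inside ∷ A)  _ = fzero , here
nonempty⁻ (outside ∷ A) h = let z , z∈A = nonempty⁻ A h in fsuc z , there z∈A

meetsFrom⁺ : ∀ {n} q (A : Subset n) {z} → z ∈ A → q ≤ toℕ z → meetsFrom q A ≡ true
meetsFrom⁺ zero    A       z∈A         _         = nonempty⁺ A z∈A
meetsFrom⁺ (suc q) (_ ∷ A) (there z∈A) (s≤s q≤z) = meetsFrom⁺ q A z∈A q≤z

meetsFrom⁻ : ∀ {n} q (A : Subset n) → meetsFrom q A ≡ true → ∃ λ z → z ∈ A × q ≤ toℕ z
meetsFrom⁻ zero    A       h = let z , z∈A = nonempty⁻ A h in z , z∈A , z≤n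
meetsFrom⁻ (suc q) (_ ∷ A) h = let z , z∈A , q≤z = meetsFrom⁻ q A h in fsuc z , there z∈A , s≤s q≤z

avoidsBelow⁻ : ∀ {n} p (A : Subset n) → avoidsBelow p A ≡ true → ∀ {z} → z ∈ A → p ≤ toℕ z
avoidsBelow⁻ zero    A             _ _           = z≤n
avoidsBelow⁻ (suc p) (outside ∷ A) h (there z∈A) = s≤s (avoidsBelow⁻ p A h z∈A)

avoidsBelow-false : ∀ {n} p (A : Subset n) → avoidsBelow p A ≡ false → ∃ λ z → z ∈ A × toℕ z < p
avoidsBelow-false (suc p) (inside ∷ A)  _ = fzero , here , s≤s z≤n
avoidsBelow-false (suc p) (outside ∷ A) h =
  let z , z∈A , z<p = avoidsBelow-false p A h in fsuc z , there z∈A , s≤s z<p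

isPair⁺ : ∀ {n} (A : Subset n) → ∣ A ∣ ≡ 2 → isPair A ≡ true
isPair⁺ A ∣A∣≡2 rewrite ∣A∣≡2 = refl

isPair⁻ : ∀ {n} (A : Subset n) → isPair A ≡ true → ∣ A ∣ ≡ 2
isPair⁻ A h = ≡ᵇ⇒≡ ∣ A ∣ 2 (Equivalence.from T-≡ h)

upperPair⁺ : ∀ {n} p q (A : Subset n) →
  avoidsBelow p A ≡ true → ∣ A ∣ ≡ 2 → meetsFrom q A ≡ true → upperPair p q A ≡ true
upperPair⁺ p q A avoids ∣A∣≡2 meets =
  ∧-true {avoidsBelow p A} avoids (∧-true {isPair A} (isPair⁺ A ∣A∣≡2) meets)

upperPair⁻ : ∀ {n} p q (A : Subset n) → upperPair p q A ≡ true →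
  avoidsBelow p A ≡ true × ∣ A ∣ ≡ 2 × meetsFrom q A ≡ true
upperPair⁻ p q A h = ∧-conicalˡ _ _ h , isPair⁻ A (∧-conicalˡ _ _ rest) , ∧-conicalʳ (isPair A) _ rest
  where rest = ∧-conicalʳ (avoidsBelow p A) _ h

missing⁺ : ∀ {n} {F : Family n} {A} → ∣ A ∣ ≡ 2 → F A ≡ false → missing F A ≡ true
missing⁺ {A = A} ∣A∣≡2 A∉F = ∧-true {isPair A} (isPair⁺ A ∣A∣≡2) (cong not A∉F)

missing⁻ : ∀ {n} {F : Family n} {A} → missing F A ≡ true → ∣ A ∣ ≡ 2 × F A ≡ false
missing⁻ {F = F} {A} h = isPair⁻ A (∧-conicalˡ _ _ h) , not-injective (∧-conicalʳ (isPair A) (not (F A)) h)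

count-empty : ∀ N → countᵇ (λ (A : Subset N) → ∣ A ∣ ≡ᵇ 0) (allSubsets N) ≡ 1
count-empty zero    = refl
count-empty (suc N) =
  trans (countᵇ-allSubsets-suc N _) (cong₂ _+_ (count-empty N) (countᵇ-false (allSubsets N)))

count-singletons : ∀ N → countᵇ (λ (A : Subset N) → ∣ A ∣ ≡ᵇ 1) (allSubsets N) ≡ N
count-singletons zero    = refl
count-singletons (suc N) =
  trans (countᵇ-allSubsets-suc N _) (trans (cong₂ _+_ (count-singletons N) (count-empty N)) (+-comm N 1))

count-pairs : ∀ N → 2 * countᵇ (λ (A : Subset N) → isPair A ∧ nonempty A) (allSubsets N) + N ≡ N * N
count-pairs zero    = refl
count-pairs (suc N) = begin
  2 * countᵇ P (allSubsets (suc N)) + suc N ≡⟨ cong (λ c → 2 * c + suc N) split ⟩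
  2 * (c + N) + suc N                       ≡⟨ identity₁ c N ⟩
  (2 * c + N) + suc (N + N)                 ≡⟨ cong (_+ suc (N + N)) (count-pairs N) ⟩
  N * N + suc (N + N)                       ≡⟨ identity₂ N ⟩
  suc N * suc N                             ∎
  where
  open ≡-Reasoning
  P : Subset (suc N) → Bool
  P A = isPair A ∧ nonempty A
  c = countᵇ (λ (A : Subset N) → isPair A ∧ nonempty A) (allSubsets N)
  split : countᵇ P (allSubsets (suc N)) ≡ c + N
  split = trans (countᵇ-allSubsets-suc N P)
    (cong (_+_ c) (trans (countᵇ-cong (λ A → ∧-identityʳ (∣ A ∣ ≡ᵇ 1)) (allSubsets N)) (count-singletons N)))
  identity₁ : ∀ c N → 2 * (c + N) + suc N ≡ (2 * c + N) + suc (N + N)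
  identity₁ = solve-∀
  identity₂ : ∀ N → N * N + suc (N + N) ≡ suc N * suc N
  identity₂ = solve-∀

count-emptyMeeting : ∀ N q →
  countᵇ (λ (A : Subset N) → (∣ A ∣ ≡ᵇ 0) ∧ meetsFrom q A) (allSubsets N) ≡ 0
count-emptyMeeting zero    zero    = refl
count-emptyMeeting zero    (suc q) = refl
count-emptyMeeting (suc N) zero    =
  trans (countᵇ-allSubsets-suc N _) (cong₂ _+_ (count-emptyMeeting N zero) (countᵇ-false (allSubsets N)))
count-emptyMeeting (suc N) (suc q) =
  trans (countᵇ-allSubsets-suc N _) (cong₂ _+_ (count-emptyMeeting N q) (countᵇ-false (allSubsets N)))

count-singletonsMeeting : ∀ N q →
  countᵇ (λ (A : Subset N) → (∣ A ∣ ≡ᵇ 1) ∧ meetsFrom q A) (allSubsets N) ≡ N ∸ q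
count-singletonsMeeting zero    zero    = refl
count-singletonsMeeting zero    (suc q) = refl
count-singletonsMeeting (suc N) zero    =
  trans (countᵇ-allSubsets-suc N _)
    (trans (cong₂ _+_ (count-singletonsMeeting N zero)
                      (trans (countᵇ-cong (λ A → ∧-identityʳ (∣ A ∣ ≡ᵇ 0)) (allSubsets N)) (count-empty N)))
           (+-comm N 1))
count-singletonsMeeting (suc N) (suc q) =
  trans (countᵇ-allSubsets-suc N _)
    (trans (cong₂ _+_ (count-singletonsMeeting N q) (count-emptyMeeting N q)) (+-identityʳ (N ∸ q)))

count-pairsMeeting : ∀ q k →
  2 * countᵇ (λ (A : Subset (q + k)) → isPair A ∧ meetsFrom q A) (allSubsets (q + k)) + k ≡ k * k + 2 * q * k
count-pairsMeeting zero    k = trans (count-pairs k) (sym (+-identityʳ (k * k)))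
count-pairsMeeting (suc q) k = begin
  2 * countᵇ P (allSubsets (suc (q + k))) + k ≡⟨ cong (λ c → 2 * c + k) split ⟩
  2 * (c + k) + k                              ≡⟨ identity₁ c k ⟩
  (2 * c + k) + 2 * k                          ≡⟨ cong (_+ 2 * k) (count-pairsMeeting q k) ⟩
  k * k + 2 * q * k + 2 * k                    ≡⟨ identity₂ k q ⟩
  k * k + 2 * suc q * k                        ∎
  where
  open ≡-Reasoning
  P : Subset (suc (q + k)) → Bool
  P A = isPair A ∧ meetsFrom (suc q) A
  c = countᵇ (λ (A : Subset (q + k)) → isPair A ∧ meetsFrom q A) (allSubsets (q + k))
  split : countᵇ P (allSubsets (suc (q + k))) ≡ c + k
  split = trans (countᵇ-allSubsets-suc (q + k) P)
    (cong (_+_ c) (trans (count-singletonsMeeting (q + k) q) (m+n∸m≡n q k)))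
  identity₁ : ∀ c k → 2 * (c + k) + k ≡ (2 * c + k) + 2 * k
  identity₁ = solve-∀
  identity₂ : ∀ k q → k * k + 2 * q * k + 2 * k ≡ k * k + 2 * suc q * k
  identity₂ = solve-∀

count-upperPairs : ∀ p q N →
  countᵇ (upperPair p (p + q)) (allSubsets (p + N))
  ≡ countᵇ (λ (A : Subset N) → isPair A ∧ meetsFrom q A) (allSubsets N)
count-upperPairs zero    q N = refl
count-upperPairs (suc p) q N =
  trans (countᵇ-allSubsets-suc (p + N) _)
    (trans (cong₂ _+_ (count-upperPairs p q N) (countᵇ-false (allSubsets (p + N)))) (+-identityʳ _))

-- With n = 2(a + b + 1) + e and k = n − (a + 2b + 1) = e + a + 1, the number of upper pairs
-- {x < y}, x ≥ a, y ≥ a + 2b + 1, is C(k, 2) + (2b + 1)k; twicePairs a b e is twice that.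
twicePairs : ℕ → ℕ → ℕ → ℕ
twicePairs a b e = (suc (e + a) + 4 * b + 1) * suc (e + a)

twice-count-upperPairs : ∀ a b e {N} → N ≡ a + (suc (b + b) + suc (e + a)) →
  2 * countᵇ (upperPair a (a + suc (b + b))) (allSubsets N) ≡ twicePairs a b e
twice-count-upperPairs a b e refl = +-cancelʳ-≡ k _ _ (begin
  2 * countᵇ (upperPair a (a + r)) (allSubsets (a + (r + k))) + k
    ≡⟨ cong (λ c → 2 * c + k) (count-upperPairs a r (r + k)) ⟩
  2 * countᵇ (λ (A : Subset (r + k)) → isPair A ∧ meetsFrom r A) (allSubsets (r + k)) + k
    ≡⟨ count-pairsMeeting r k ⟩
  k * k + 2 * r * k
    ≡⟨ identity a b e ⟩
  twicePairs a b e + k ∎)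
  where
  open ≡-Reasoning
  r = suc (b + b)
  k = suc (e + a)
  identity : ∀ a b e → suc (e + a) * suc (e + a) + 2 * suc (b + b) * suc (e + a)
                     ≡ (suc (e + a) + 4 * b + 1) * suc (e + a) + suc (e + a)
  identity = solve-∀

endpointMin : ℕ → ℕ → ℕ
endpointMin L e = twicePairs 0 L e ℕ.⊓ twicePairs L 0 e

-- For fixed a + b, twicePairs is a concave quadratic in a, so it lies above the chord through its
-- endpoint values (a = 0 and b = 0); the gap is 3ab.
twicePairs-weighted : ∀ a b e →
  (a + b) * twicePairs a b e ≡ b * twicePairs 0 (a + b) e + a * twicePairs (a + b) 0 e + 3 * a * b * (a + b)
twicePairs-weighted = identity
  where
  identity : ∀ a b e → (a + b) * ((suc (e + a) + 4 * b + 1) * suc (e + a))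
    ≡ b * ((suc (e + 0) + 4 * (a + b) + 1) * suc (e + 0))
      + a * ((suc (e + (a + b)) + 4 * 0 + 1) * suc (e + (a + b))) + 3 * a * b * (a + b)
  identity = solve-∀

endpointMin-<-interior : ∀ a b e → endpointMin (suc a + suc b) e < twicePairs (suc a) (suc b) e
endpointMin-<-interior a b e = *-cancelˡ-< L m (twicePairs A B e) (begin-strict
  L * m                                  ≡⟨ *-distribʳ-+ m A B ⟩
  A * m + B * m                          ≡⟨ +-comm (A * m) (B * m) ⟩
  B * m + A * m                          ≤⟨ +-mono-≤ (*-monoʳ-≤ B m≤left) (*-monoʳ-≤ A m≤right) ⟩
  B * twicePairs 0 L e + A * twicePairs L 0 e
                                         <⟨ m<m+n _ (s≤s z≤n) ⟩
  B * twicePairs 0 L e + A * twicePairs L 0 e + 3 * A * B * L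
                                         ≡⟨ twicePairs-weighted A B e ⟨
  L * twicePairs A B e                   ∎)
  where
  open ≤-Reasoning
  A = suc a
  B = suc b
  L = A + B
  m = endpointMin L e
  m≤left : m ≤ twicePairs 0 L e
  m≤left = m⊓n≤m _ _
  m≤right : m ≤ twicePairs L 0 e
  m≤right = m⊓n≤n _ _

endpointMin-≤ : ∀ a b e → endpointMin (a + b) e ≤ twicePairs a b e
endpointMin-≤ zero    b       e = m⊓n≤m _ _
endpointMin-≤ (suc a) zero    e rewrite +-identityʳ a = m⊓n≤n _ _
endpointMin-≤ (suc a) (suc b) e = <⇒≤ (endpointMin-<-interior a b e)

endpointMin-≡ : ∀ a b e → endpointMin (a + b) e ≡ twicePairs a b e → a ≡ 0 ⊎ b ≡ 0
endpointMin-≡ zero    _       _ _  = inj₁ refl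
endpointMin-≡ (suc a) zero    _ _  = inj₂ refl
endpointMin-≡ (suc a) (suc b) e eq = contradiction eq (<⇒≢ (endpointMin-<-interior a b e))

∣p∣≡0⇒p≡⊥ : ∀ {n} (A : Subset n) → ∣ A ∣ ≡ 0 → A ≡ ⊥
∣p∣≡0⇒p≡⊥ []            _ = refl
∣p∣≡0⇒p≡⊥ (outside ∷ A) h = cong (outside ∷_) (∣p∣≡0⇒p≡⊥ A h)

∣p∣≡1⇒p≡⁅x⁆ : ∀ {n} (A : Subset n) → ∣ A ∣ ≡ 1 → ∃ λ x → A ≡ ⁅ x ⁆
∣p∣≡1⇒p≡⁅x⁆ (outside ∷ A) h = let x , A≡⁅x⁆ = ∣p∣≡1⇒p≡⁅x⁆ A h in fsuc x , cong (outside ∷_) A≡⁅x⁆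
∣p∣≡1⇒p≡⁅x⁆ (inside ∷ A)  h = fzero , cong (inside ∷_) (∣p∣≡0⇒p≡⊥ A (suc-injective h))

∣p∣≡2⇒p≡⁅x⁆∪⁅y⁆ : ∀ {n} (A : Subset n) → ∣ A ∣ ≡ 2 → ∃₂ λ x y → toℕ x < toℕ y × A ≡ ⁅ x ⁆ ∪ ⁅ y ⁆
∣p∣≡2⇒p≡⁅x⁆∪⁅y⁆ (outside ∷ A) h =
  let x , y , x<y , A≡ = ∣p∣≡2⇒p≡⁅x⁆∪⁅y⁆ A h in fsuc x , fsuc y , s≤s x<y , cong (outside ∷_) A≡
∣p∣≡2⇒p≡⁅x⁆∪⁅y⁆ (inside ∷ A)  h =
  let y , A≡⁅y⁆ = ∣p∣≡1⇒p≡⁅x⁆ A (suc-injective h)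
  in fzero , fsuc y , s≤s z≤n , cong (inside ∷_) (trans A≡⁅y⁆ (sym (∪-identityˡ ⁅ y ⁆)))

x∈⁅x⁆∪⁅y⁆ : ∀ {n} (x y : Fin n) → x ∈ ⁅ x ⁆ ∪ ⁅ y ⁆
x∈⁅x⁆∪⁅y⁆ x y = x∈p∪q⁺ (inj₁ (x∈⁅x⁆ x))

y∈⁅x⁆∪⁅y⁆ : ∀ {n} (x y : Fin n) → y ∈ ⁅ x ⁆ ∪ ⁅ y ⁆
y∈⁅x⁆∪⁅y⁆ x y = x∈p∪q⁺ {p = ⁅ x ⁆} (inj₂ (x∈⁅x⁆ y))

∈-⁅x⁆∪⁅y⁆⁻ : ∀ {n} (x y : Fin n) {z} → z ∈ ⁅ x ⁆ ∪ ⁅ y ⁆ → z ≡ x ⊎ z ≡ y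
∈-⁅x⁆∪⁅y⁆⁻ x y z∈ = Sum.map (x∈⁅y⁆⇒x≡y x) (x∈⁅y⁆⇒x≡y y) (x∈p∪q⁻ ⁅ x ⁆ ⁅ y ⁆ z∈)

lookup-ext : ∀ {n} {A : Set} {xs ys : Vec A n} → (∀ i → lookup xs i ≡ lookup ys i) → xs ≡ ys
lookup-ext {xs = xs} {ys} eq = trans (sym (tabulate∘lookup xs)) (trans (tabulate-cong eq) (tabulate∘lookup ys))

lookup-⁅x⁆-x : ∀ {n} (x : Fin n) → lookup ⁅ x ⁆ x ≡ inside
lookup-⁅x⁆-x x = []=⇒lookup (x∈⁅x⁆ x)

lookup-⁅y⁆-x : ∀ {n} {x y : Fin n} → x ≢ y → lookup ⁅ y ⁆ x ≡ outside
lookup-⁅y⁆-x {x = x} {y} x≢y with lookup ⁅ y ⁆ x in eq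
... | outside = refl
... | inside  = contradiction (x∈⁅y⁆⇒x≡y y (lookup⇒[]= x ⁅ y ⁆ eq)) x≢y

lookup-∪ : ∀ {n} (A B : Subset n) z → lookup (A ∪ B) z ≡ lookup A z ∨ lookup B z
lookup-∪ A B z = lookup-zipWith _∨_ z A B

shiftable-pair : ∀ {n} {u v w : Fin n} → w ≢ u → w ≢ v →
  lookup (⁅ u ⁆ ∪ ⁅ v ⁆) v ∧ not (lookup (⁅ u ⁆ ∪ ⁅ v ⁆) w) ≡ true
shiftable-pair {u = u} {v} {w} w≢u w≢v
  rewrite lookup-∪ ⁅ u ⁆ ⁅ v ⁆ v | lookup-∪ ⁅ u ⁆ ⁅ v ⁆ w | lookup-⁅x⁆-x v
        | lookup-⁅y⁆-x w≢u | lookup-⁅y⁆-x w≢v | ∨-zeroʳ (lookup ⁅ u ⁆ v) = refl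

shiftSet-pair : ∀ {n} {u v w : Fin n} → w ≢ u → w ≢ v → u ≢ v →
  shiftSet w v (⁅ u ⁆ ∪ ⁅ v ⁆) ≡ ⁅ u ⁆ ∪ ⁅ w ⁆
shiftSet-pair {u = u} {v} {w} w≢u w≢v u≢v rewrite shiftable-pair {u = u} w≢u w≢v = lookup-ext pointwise
  where
  A = ⁅ u ⁆ ∪ ⁅ v ⁆
  pointwise : ∀ z → lookup ((A [ v ]≔ outside) [ w ]≔ inside) z ≡ lookup (⁅ u ⁆ ∪ ⁅ w ⁆) z
  pointwise z with z ≟ᶠ w
  ... | yes refl rewrite lookup∘update z (A [ v ]≔ outside) inside | lookup-∪ ⁅ u ⁆ ⁅ z ⁆ z | lookup-⁅x⁆-x z =
    sym (∨-zeroʳ _)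
  ... | no z≢w with z ≟ᶠ v
  ...   | yes refl rewrite lookup∘update′ z≢w (A [ z ]≔ outside) inside | lookup∘update z A outside
                         | lookup-∪ ⁅ u ⁆ ⁅ w ⁆ z | lookup-⁅y⁆-x (u≢v ∘ sym) | lookup-⁅y⁆-x (w≢v ∘ sym) = refl
  ...   | no z≢v rewrite lookup∘update′ z≢w (A [ v ]≔ outside) inside | lookup∘update′ z≢v A outside
                       | lookup-∪ ⁅ u ⁆ ⁅ v ⁆ z | lookup-∪ ⁅ u ⁆ ⁅ w ⁆ z
                       | lookup-⁅y⁆-x z≢v | lookup-⁅y⁆-x z≢w = refl

shifted-pair : ∀ {n} {F : Family n} → Shifted F → ∀ {u v w} → toℕ w ≤ toℕ v → w ≢ u → u ≢ v →
  F (⁅ u ⁆ ∪ ⁅ v ⁆) ≡ true → F (⁅ u ⁆ ∪ ⁅ w ⁆) ≡ true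
shifted-pair {F = F} sh {u} {v} {w} w≤v w≢u u≢v uv∈F with m≤n⇒m<n∨m≡n w≤v
... | inj₂ w≡v rewrite toℕ-injective w≡v = uv∈F
... | inj₁ w<v = subst (λ X → F X ≡ true) (shiftSet-pair w≢u (<⇒≢ᶠ w<v) u≢v)
                   (proj₁ (sh w v w<v _) (inj₁ (_ , uv∈F , refl)))

shifted-pair-downward : ∀ {n} {F : Family n} → Shifted F → ∀ {x y x′ y′} →
  toℕ x < toℕ y → toℕ x′ < toℕ y′ → toℕ x′ ≤ toℕ x → toℕ y′ ≤ toℕ y →
  F (⁅ x ⁆ ∪ ⁅ y ⁆) ≡ true → F (⁅ x′ ⁆ ∪ ⁅ y′ ⁆) ≡ true
shifted-pair-downward {F = F} sh {x} {y} {x′} {y′} x<y x′<y′ x′≤x y′≤y xy∈F =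
  shifted-pair sh y′≤y (<⇒≢ᶠ x′<y′ ∘ sym) x′≢y (∈F-comm yx′∈F)
  where
  x′≢y = <⇒≢ᶠ (≤-<-trans x′≤x x<y)
  ∈F-comm : ∀ {a b} → F (⁅ a ⁆ ∪ ⁅ b ⁆) ≡ true → F (⁅ b ⁆ ∪ ⁅ a ⁆) ≡ true
  ∈F-comm {a} {b} = subst (λ X → F X ≡ true) (∪-comm ⁅ a ⁆ ⁅ b ⁆)
  yx′∈F : F (⁅ y ⁆ ∪ ⁅ x′ ⁆) ≡ true
  yx′∈F = shifted-pair sh x′≤x x′≢y (<⇒≢ᶠ x<y ∘ sym) (∈F-comm xy∈F)

upperPairs-missing : ∀ {n} {F : Family n} {p q j} → Shifted F → p < j → j ≤ q →
  ¬ PairIn F (suc p) (suc j) → upperPair p q ⇒ᵇ missing F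
upperPairs-missing {n} {F} {p} {q} {j} sh p<j j≤q pj∉F A up with upperPair⁻ p q A up
... | avoids , ∣A∣≡2 , meets with ∣p∣≡2⇒p≡⁅x⁆∪⁅y⁆ A ∣A∣≡2
... | x , y , x<y , refl = missing⁺ {F = F} {⁅ x ⁆ ∪ ⁅ y ⁆} ∣A∣≡2 (¬-not (pj∉F ∘ pj∈F))
  where
  p≤x : p ≤ toℕ x
  p≤x = avoidsBelow⁻ p _ avoids (x∈⁅x⁆∪⁅y⁆ x y)
  j≤y : j ≤ toℕ y
  j≤y with meetsFrom⁻ q _ meets
  ... | z , z∈ , q≤z with ∈-⁅x⁆∪⁅y⁆⁻ x y z∈
  ...   | inj₁ refl = ≤-trans j≤q (≤-trans q≤z (<⇒≤ x<y))
  ...   | inj₂ refl = ≤-trans j≤q q≤z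
  p<n = ≤-<-trans p≤x (toℕ<n x)
  j<n = ≤-<-trans j≤y (toℕ<n y)
  p≡ = toℕ-fromℕ< p<n
  j≡ = toℕ-fromℕ< j<n
  pj∈F : F (⁅ x ⁆ ∪ ⁅ y ⁆) ≡ true → PairIn F (suc p) (suc j)
  pj∈F xy∈F = fromℕ< p<n , fromℕ< j<n , cong suc p≡ , cong suc j≡ ,
    shifted-pair-downward sh x<y (subst₂ _<_ (sym p≡) (sym j≡) p<j)
      (subst (_≤ toℕ x) (sym p≡) p≤x) (subst (_≤ toℕ y) (sym j≡) j≤y) xy∈F

MissingPairOfSum≤ : ∀ {n} → Family n → ℕ → Set
MissingPairOfSum≤ F S = ∃₂ λ i j → 1 ≤ i × i < j × i + j ≤ S × ¬ PairIn F i j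

missingPair-complement : ∀ {n} {F : Family n} {i S S′} → 1 ≤ i → i + i < S → S ≤ S′ →
  ¬ PairIn F i (S ∸ i) → MissingPairOfSum≤ F S′
missingPair-complement {i = i} {S} 1≤i 2i<S S≤S′ ∉F =
  i , S ∸ i , 1≤i , m+n≤o⇒m≤o∸n (suc i) 2i<S , ≤-trans (≤-reflexive (m+[n∸m]≡n i≤S)) S≤S′ , ∉F
  where i≤S = m+n≤o⇒m≤o i (<⇒≤ 2i<S)

¬2∣⇒odd : ∀ m → ¬ 2 ∣ m → ∃ λ u → m ≡ suc (u * 2)
¬2∣⇒odd zero          ¬2∣m = contradiction (divides 0 refl) ¬2∣m
¬2∣⇒odd (suc zero)    _    = 0 , refl
¬2∣⇒odd (suc (suc m)) ¬2∣m with ¬2∣⇒odd m (λ { (divides q refl) → ¬2∣m (divides (suc q) refl) })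
... | u , refl = suc u , refl

DCond⇒missingPair : ∀ {n} {F : Family n} {ℓ t m} → 1 ≤ ℓ → m ≤ t * 2 → DCond ℓ F m →
  MissingPairOfSum≤ F (2 * ℓ + t * 2 + 1)
DCond⇒missingPair {F = F} {ℓ} _ m≤d (inj₁ (divides u refl , i , 1≤i , i≤ , ∉F)) =
  missingPair-complement {F = F} 1≤i 2i<S (+-monoˡ-≤ 1 (+-monoʳ-≤ (2 * ℓ) m≤d)) ∉F
  where
  open ≤-Reasoning
  identity : ∀ ℓ u → (ℓ + u) + (ℓ + u) ≡ 2 * ℓ + u * 2
  identity = solve-∀
  2i<S : i + i < 2 * ℓ + u * 2 + 1
  2i<S = begin-strict
    i + i                             ≤⟨ +-mono-≤ i≤ i≤ ⟩
    (ℓ + u * 2 / 2) + (ℓ + u * 2 / 2) ≡⟨ cong (λ h → (ℓ + h) + (ℓ + h)) (m*n/n≡m u 2) ⟩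
    (ℓ + u) + (ℓ + u)                 ≡⟨ identity ℓ u ⟩
    2 * ℓ + u * 2                     <⟨ m<m+n _ (s≤s z≤n) ⟩
    2 * ℓ + u * 2 + 1                 ∎
DCond⇒missingPair {F = F} {ℓ} {m = m} 1≤ℓ m≤d (inj₂ (_ , inj₁ ∉F)) =
  missingPair-complement {F = F} (s≤s z≤n) (+-monoˡ-≤ 1 (≤-trans (*-monoʳ-≤ 2 1≤ℓ) (m≤m+n (2 * ℓ) m)))
    (+-monoˡ-≤ 1 (+-monoʳ-≤ (2 * ℓ) m≤d)) (subst (¬_ ∘ PairIn F 1) (sym (m+n∸n≡m (2 * ℓ + m) 1)) ∉F)
DCond⇒missingPair {F = F} {ℓ} {t} {m} _ m≤d (inj₂ (¬2∣m , inj₂ (i , 3≤i , i≤ , ∉F))) with ¬2∣⇒odd m ¬2∣m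
... | u , refl = missingPair-complement {F = F} (≤-trans (s≤s z≤n) 3≤i) 2i<S S≤ ∉F
  where
  open ≤-Reasoning
  identity₁ : ∀ u → suc (u * 2) + 1 ≡ suc u * 2
  identity₁ = solve-∀
  identity₂ : ∀ ℓ u → (ℓ + suc u) + (ℓ + suc u) ≡ 2 * ℓ + suc (u * 2) + 1
  identity₂ = solve-∀
  identity₃ : ∀ ℓ u → 2 * ℓ + suc (u * 2) + 2 ≡ 2 * ℓ + suc u * 2 + 1
  identity₃ = solve-∀
  half : (suc (u * 2) + 1) / 2 ≡ suc u
  half = trans (cong (_/ 2) (identity₁ u)) (m*n/n≡m (suc u) 2)
  2i<S : i + i < 2 * ℓ + suc (u * 2) + 2
  2i<S = begin-strict
    i + i                                          ≤⟨ +-mono-≤ i≤ i≤ ⟩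
    (ℓ + (suc (u * 2) + 1) / 2) + (ℓ + (suc (u * 2) + 1) / 2) ≡⟨ cong (λ h → (ℓ + h) + (ℓ + h)) half ⟩
    (ℓ + suc u) + (ℓ + suc u)                      ≡⟨ identity₂ ℓ u ⟩
    2 * ℓ + suc (u * 2) + 1                        <⟨ +-monoʳ-< (2 * ℓ + suc (u * 2)) (s≤s (s≤s z≤n)) ⟩
    2 * ℓ + suc (u * 2) + 2                        ∎
  S≤ : 2 * ℓ + suc (u * 2) + 2 ≤ 2 * ℓ + t * 2 + 1
  S≤ = begin
    2 * ℓ + suc (u * 2) + 2 ≡⟨ identity₃ ℓ u ⟩
    2 * ℓ + suc u * 2 + 1   ≤⟨ +-monoˡ-≤ 1 (+-monoʳ-≤ (2 * ℓ) (*-monoˡ-≤ 2 (*-cancelʳ-< 2 u t m≤d))) ⟩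
    2 * ℓ + t * 2 + 1       ∎

smaller-≤-half : ∀ {x y L} → x < y → x + y ≤ 2 * L + 1 → x ≤ L
smaller-≤-half {x} {y} {L} x<y x+y≤ = ≮⇒≥ λ L<x →
  1+n≰n (≤-trans (≤-reflexive (identity L)) (≤-trans (+-mono-≤ L<x (≤-trans L<x (<⇒≤ x<y))) x+y≤))
  where
  identity : ∀ L → suc (2 * L + 1) ≡ suc L + suc L
  identity = solve-∀

sum-pred : ∀ {x y S} → suc x + suc y ≤ 2 + S → x + y ≤ S
sum-pred {x} {y} {S} h = s≤s⁻¹ (subst (_≤ suc S) (+-suc x y) (s≤s⁻¹ h))

missingPair⇒upperPairsMissing : ∀ {n} {F : Family n} {L} → Shifted F →
  MissingPairOfSum≤ F (2 + (2 * L + 1)) →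
  ∃₂ λ a b → a + b ≡ L × upperPair a (a + suc (b + b)) ⇒ᵇ missing F
missingPair⇒upperPairsMissing {F = F} {L} sh (suc x , suc y , _ , s≤s x<y , sum≤ , ∉F)
  with m≤n⇒∃[o]m+o≡n (smaller-≤-half {L = L} x<y (sum-pred sum≤))
... | b , refl = x , b , refl , upperPairs-missing {F = F} sh x<y y≤ ∉F
  where
  identity : ∀ x b → 2 * (x + b) + 1 ≡ x + (x + suc (b + b))
  identity = solve-∀
  y≤ : y ≤ x + suc (b + b)
  y≤ = +-cancelˡ-≤ x y _ (subst (x + y ≤_) (identity x b) (sum-pred sum≤))

PairsWithin : ∀ {n} → Family n → ℕ → Set
PairsWithin {n} F m = (A : Subset n) → ∣ A ∣ ≡ 2 →
  (F A ≡ true → SubsetOfInit A m) × (SubsetOfInit A m → F A ≡ true)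

PairsMeeting : ∀ {n} → Family n → ℕ → Set
PairsMeeting {n} F m = (A : Subset n) → ∣ A ∣ ≡ 2 →
  (F A ≡ true → MeetsInit A m) × (MeetsInit A m → F A ≡ true)

Extremal : ∀ {n} → Family n → ℕ → ℕ → Set
Extremal F ℓ d = PairsWithin F (2 * ℓ + d ∸ 1) ⊎ PairsMeeting F (ℓ + d / 2 ∸ 1)

∉F⇔U : ∀ {n} {F : Family n} {U} → missing F ⇒ᵇ U → U ⇒ᵇ missing F → ∀ {A} → ∣ A ∣ ≡ 2 →
  (F A ≡ false → U A ≡ true) × (U A ≡ true → F A ≡ false)
∉F⇔U {F = F} miss⇒U U⇒miss {A} ∣A∣≡2 =
  (λ A∉F → miss⇒U A (missing⁺ {F = F} ∣A∣≡2 A∉F)) , λ A∈U → proj₂ (missing⁻ {F = F} (U⇒miss A A∈U))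

missing≡upperPairs⇒pairsWithin : ∀ {n} {F : Family n} {Q} →
  missing F ⇒ᵇ upperPair 0 Q → upperPair 0 Q ⇒ᵇ missing F → PairsWithin F Q
missing≡upperPairs⇒pairsWithin {F = F} {Q} miss⇒up up⇒miss A ∣A∣≡2 = within , complete
  where
  ∉F⇒U = proj₁ (∉F⇔U {F = F} miss⇒up up⇒miss ∣A∣≡2)
  U⇒∉F = proj₂ (∉F⇔U {F = F} miss⇒up up⇒miss ∣A∣≡2)
  within : F A ≡ true → SubsetOfInit A Q
  within A∈F x x∈A = ≰⇒> λ Q≤x → not-¬ A∈F (U⇒∉F (upperPair⁺ 0 Q A refl ∣A∣≡2 (meetsFrom⁺ Q A x∈A Q≤x)))
  complete : SubsetOfInit A Q → F A ≡ true
  complete A⊆Q = ¬-not λ A∉F →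
    let _ , _ , meets = upperPair⁻ 0 Q A (∉F⇒U A∉F)
        z , z∈A , Q≤z = meetsFrom⁻ Q A meets
    in <⇒≱ (A⊆Q z z∈A) Q≤z

pair-avoidsBelow⇒meetsFrom : ∀ {n} {P q} (A : Subset n) → q ≤ suc P → ∣ A ∣ ≡ 2 →
  avoidsBelow P A ≡ true → meetsFrom q A ≡ true
pair-avoidsBelow⇒meetsFrom {P = P} {q} A q≤P+1 ∣A∣≡2 avoids with ∣p∣≡2⇒p≡⁅x⁆∪⁅y⁆ A ∣A∣≡2
... | x , y , x<y , refl =
  meetsFrom⁺ q _ (y∈⁅x⁆∪⁅y⁆ x y) (≤-trans q≤P+1 (≤-<-trans (avoidsBelow⁻ P _ avoids (x∈⁅x⁆∪⁅y⁆ x y)) x<y))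

missing≡upperPairs⇒pairsMeeting : ∀ {n} {F : Family n} {P q} → q ≤ suc P →
  missing F ⇒ᵇ upperPair P q → upperPair P q ⇒ᵇ missing F → PairsMeeting F P
missing≡upperPairs⇒pairsMeeting {F = F} {P} {q} q≤P+1 miss⇒up up⇒miss A ∣A∣≡2 = meets , complete
  where
  ∉F⇒U = proj₁ (∉F⇔U {F = F} miss⇒up up⇒miss ∣A∣≡2)
  U⇒∉F = proj₂ (∉F⇔U {F = F} miss⇒up up⇒miss ∣A∣≡2)
  meets : F A ≡ true → MeetsInit A P
  meets A∈F with avoidsBelow P A in avoids
  ... | false = avoidsBelow-false P A avoids
  ... | true  = contradiction (U⇒∉F (upperPair⁺ P q A avoids ∣A∣≡2
                  (pair-avoidsBelow⇒meetsFrom A q≤P+1 ∣A∣≡2 avoids))) (not-¬ A∈F)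
  complete : MeetsInit A P → F A ≡ true
  complete (z , z∈A , z<P) = ¬-not λ A∉F →
    let avoids , _ = upperPair⁻ P q A (∉F⇒U A∉F)
    in <⇒≱ z<P (avoidsBelow⁻ P A avoids z∈A)

y2≡0⇒pairsWithin : ∀ {n} {F : Family n} {Q} → y2 F ≡ 0 → n ≤ Q → PairsWithin F Q
y2≡0⇒pairsWithin {n} {F} y2≡0 n≤Q A ∣A∣≡2 = (λ _ x _ → ≤-trans (toℕ<n x) n≤Q) , λ _ → ¬-not λ A∉F →
  not-¬ (missing⁺ {F = F} ∣A∣≡2 A∉F) (countᵇ≡0⇒false (missing F) (allSubsets n) y2≡0 (∈-allSubsets A))

-- The right-hand side of the theorem, with 3c generalised to C.
bound : ℕ → ℕ → ℕ → ℤ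
bound ℓ C d = ((+ (4 * ℓ + C + d) - + 2) ℤ.* (+ (C + 1) - + d))
              ⊓ ((+ (ℓ + C + 1) - + (d / 2)) ℤ.* (+ (ℓ + C) - + (d / 2)))

[+m]-[+n]≡+o : ∀ {m} n o → m ≡ n + o → + m - + n ≡ + o
[+m]-[+n]≡+o n o refl =
  trans (ℤₚ.m-n≡m⊖n (n + o) n) (trans (ℤₚ.⊖-≥ (m≤m+n n o)) (cong +_ (m+n∸m≡n n o)))

bound-eval : ∀ ℓ′ t e → bound (suc ℓ′) (t * 2 + e) (t * 2) ≡ + endpointMin (ℓ′ + t) e
bound-eval ℓ′ t e = cong₂ _⊓_ left right
  where
  product : ∀ {x x′} y u y′ u′ → x ≡ y + u → x′ ≡ y′ + u′ → (+ x - + y) ℤ.* (+ x′ - + y′) ≡ + (u * u′)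
  product y u y′ u′ x≡ x′≡ =
    trans (cong₂ ℤ._*_ ([+m]-[+n]≡+o y u x≡) ([+m]-[+n]≡+o y′ u′ x′≡)) (sym (ℤₚ.pos-* u u′))
  half : ∀ {u} → t + u ≡ t * 2 / 2 + u
  half {u} = cong (_+ u) (sym (m*n/n≡m t 2))
  identity₁ : ∀ ℓ′ t e → 4 * suc ℓ′ + (t * 2 + e) + t * 2 ≡ 2 + (suc (e + 0) + 4 * (ℓ′ + t) + 1)
  identity₁ = solve-∀
  identity₂ : ∀ t e → t * 2 + e + 1 ≡ t * 2 + suc (e + 0)
  identity₂ = solve-∀
  identity₃ : ∀ ℓ′ t e → suc ℓ′ + (t * 2 + e) + 1 ≡ t + (suc (e + (ℓ′ + t)) + 4 * 0 + 1)
  identity₃ = solve-∀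
  identity₄ : ∀ ℓ′ t e → suc ℓ′ + (t * 2 + e) ≡ t + suc (e + (ℓ′ + t))
  identity₄ = solve-∀
  left : (+ (4 * suc ℓ′ + (t * 2 + e) + t * 2) - + 2) ℤ.* (+ (t * 2 + e + 1) - + (t * 2))
         ≡ + twicePairs 0 (ℓ′ + t) e
  left = product 2 _ (t * 2) _ (identity₁ ℓ′ t e) (identity₂ t e)
  right : (+ (suc ℓ′ + (t * 2 + e) + 1) - + (t * 2 / 2)) ℤ.* (+ (suc ℓ′ + (t * 2 + e)) - + (t * 2 / 2))
          ≡ + twicePairs (ℓ′ + t) 0 e
  right = product (t * 2 / 2) _ (t * 2 / 2) _ (trans (identity₃ ℓ′ t e) half) (trans (identity₄ ℓ′ t e) half)

bound-nonPos : ∀ ℓ′ C t → C < t * 2 → bound (suc ℓ′) C (t * 2) ℤ.≤ 0ℤ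
bound-nonPos ℓ′ C t C<d = ℤₚ.≤-trans (ℤₚ.i⊓j≤i _ _) (begin
  (+ (4 * suc ℓ′ + C + t * 2) - + 2) ℤ.* (+ (C + 1) - + (t * 2))
    ≡⟨ cong (ℤ._* _) ([+m]-[+n]≡+o 2 k (identity ℓ′ C t)) ⟩
  + k ℤ.* (+ (C + 1) - + (t * 2))
    ≤⟨ ℤₚ.*-monoˡ-≤-nonNeg (+ k) (ℤₚ.i≤j⇒i-j≤0 (+≤+ C+1≤d)) ⟩
  + k ℤ.* 0ℤ
    ≡⟨ ℤₚ.*-zeroʳ (+ k) ⟩
  0ℤ ∎)
  where
  open ℤₚ.≤-Reasoning
  k = 4 * ℓ′ + 2 + C + t * 2
  identity : ∀ ℓ′ C t → 4 * suc ℓ′ + C + t * 2 ≡ 2 + (4 * ℓ′ + 2 + C + t * 2)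
  identity = solve-∀
  C+1≤d : C + 1 ≤ t * 2
  C+1≤d = subst (_≤ t * 2) (+-comm 1 C) C<d

missing≡upperPairs⇒extremal : ∀ {n} {F : Family n} a b → a ≡ 0 ⊎ b ≡ 0 →
  missing F ⇒ᵇ upperPair a (a + suc (b + b)) → upperPair a (a + suc (b + b)) ⇒ᵇ missing F →
  PairsWithin F (2 * (a + b) + 1) ⊎ PairsMeeting F (a + b)
missing≡upperPairs⇒extremal {F = F} a b (inj₁ refl) miss⇒up up⇒miss =
  inj₁ (subst (PairsWithin F) (identity b) (missing≡upperPairs⇒pairsWithin miss⇒up up⇒miss))
  where
  identity : ∀ b → suc (b + b) ≡ 2 * b + 1
  identity = solve-∀
missing≡upperPairs⇒extremal {F = F} a b (inj₂ refl) miss⇒up up⇒miss =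
  inj₂ (subst (PairsMeeting F) (sym (+-identityʳ a))
    (missing≡upperPairs⇒pairsMeeting (≤-reflexive (+-comm a 1)) miss⇒up up⇒miss))

twiceY2-≥-endpointMin : ∀ {n} L e (F : Family n) → n ≡ 2 * L + e + 2 → Shifted F →
  MissingPairOfSum≤ F (2 + (2 * L + 1)) →
  endpointMin L e ≤ 2 * y2 F × (2 * y2 F ≡ endpointMin L e → PairsWithin F (2 * L + 1) ⊎ PairsMeeting F L)
twiceY2-≥-endpointMin {n} L e F n≡ sh missingPair with missingPair⇒upperPairsMissing {L = L} sh missingPair
... | a , b , refl , up⇒miss = ≤-trans (endpointMin-≤ a b e) G≤2y2 , extremal
  where
  U = upperPair a (a + suc (b + b))
  identity : ∀ a b e → 2 * (a + b) + e + 2 ≡ a + (suc (b + b) + suc (e + a))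
  identity = solve-∀
  2U≡G : 2 * countᵇ U (allSubsets n) ≡ twicePairs a b e
  2U≡G = twice-count-upperPairs a b e (trans n≡ (identity a b e))
  U≤y2 : countᵇ U (allSubsets n) ≤ y2 F
  U≤y2 = countᵇ-mono up⇒miss (allSubsets n)
  G≤2y2 : twicePairs a b e ≤ 2 * y2 F
  G≤2y2 = subst (_≤ 2 * y2 F) 2U≡G (*-monoʳ-≤ 2 U≤y2)
  extremal : 2 * y2 F ≡ endpointMin (a + b) e → PairsWithin F (2 * (a + b) + 1) ⊎ PairsMeeting F (a + b)
  extremal 2y2≡m = missing≡upperPairs⇒extremal a b (endpointMin-≡ a b e m≡G) miss⇒up up⇒miss
    where
    m≡G : endpointMin (a + b) e ≡ twicePairs a b e
    m≡G = ≤-antisym (endpointMin-≤ a b e) (subst (twicePairs a b e ≤_) 2y2≡m G≤2y2)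
    U≡y2 : countᵇ U (allSubsets n) ≡ y2 F
    U≡y2 = *-cancelˡ-≡ _ _ 2 (trans 2U≡G (trans (sym m≡G) (sym 2y2≡m)))
    miss⇒up : missing F ⇒ᵇ U
    miss⇒up A = countᵇ-mono-≡ up⇒miss (allSubsets n) U≡y2 (∈-allSubsets A)

LowerBound : ∀ {n} → Family n → ℕ → ℕ → ℕ → Set
LowerBound F ℓ C d = (bound ℓ C d ℤ.≤ + (2 * y2 F)) × (+ (2 * y2 F) ≡ bound ℓ C d → Extremal F ℓ d)

lowerBound-d≤C : ∀ {n} ℓ′ t e (F : Family n) → n ≡ 2 * suc ℓ′ + (t * 2 + e) → Shifted F →
  MissingPairOfSum≤ F (2 * suc ℓ′ + t * 2 + 1) → LowerBound F (suc ℓ′) (t * 2 + e) (t * 2)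
lowerBound-d≤C ℓ′ t e F n≡ sh missingPair rewrite bound-eval ℓ′ t e =
  +≤+ m≤2y2 , λ 2y2≡m → Sum.map within meeting (extremal (ℤₚ.+-injective 2y2≡m))
  where
  identity₁ : ∀ ℓ′ t e → 2 * suc ℓ′ + (t * 2 + e) ≡ 2 * (ℓ′ + t) + e + 2
  identity₁ = solve-∀
  identity₂ : ∀ ℓ′ t → 2 * suc ℓ′ + t * 2 + 1 ≡ 2 + (2 * (ℓ′ + t) + 1)
  identity₂ = solve-∀
  identity₃ : ∀ ℓ′ t → 2 * (ℓ′ + t) + 1 ≡ ℓ′ + (suc ℓ′ + 0) + t * 2
  identity₃ = solve-∀
  bounds = twiceY2-≥-endpointMin (ℓ′ + t) e F (trans n≡ (identity₁ ℓ′ t e)) sh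
             (subst (MissingPairOfSum≤ F) (identity₂ ℓ′ t) missingPair)
  m≤2y2 = proj₁ bounds
  extremal = proj₂ bounds
  within : PairsWithin F (2 * (ℓ′ + t) + 1) → PairsWithin F (2 * suc ℓ′ + t * 2 ∸ 1)
  within = subst (PairsWithin F) (identity₃ ℓ′ t)
  meeting : PairsMeeting F (ℓ′ + t) → PairsMeeting F (suc ℓ′ + t * 2 / 2 ∸ 1)
  meeting = subst (PairsMeeting F) (cong (_+_ ℓ′) (sym (m*n/n≡m t 2)))

lowerBound-C<d : ∀ {n} ℓ′ C t (F : Family n) → n ≡ 2 * suc ℓ′ + C → C < t * 2 →
  LowerBound F (suc ℓ′) C (t * 2)
lowerBound-C<d {n} ℓ′ C t F n≡ C<d =
  ℤₚ.≤-trans bound≤0 (+≤+ z≤n) , λ 2y2≡bound → inj₁ (y2≡0⇒pairsWithin (y2≡0 2y2≡bound) n≤)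
  where
  bound≤0 = bound-nonPos ℓ′ C t C<d
  y2≡0 : + (2 * y2 F) ≡ bound (suc ℓ′) C (t * 2) → y2 F ≡ 0
  y2≡0 eq = m+n≡0⇒m≡0 (y2 F) (n≤0⇒n≡0 (ℤₚ.drop‿+≤+ (subst (ℤ._≤ 0ℤ) (sym eq) bound≤0)))
  n≤ : n ≤ 2 * suc ℓ′ + t * 2 ∸ 1
  n≤ = m+n≤o⇒m≤o∸n n (begin
    n + 1                ≡⟨ cong (_+ 1) n≡ ⟩
    2 * suc ℓ′ + C + 1   ≡⟨ +-assoc (2 * suc ℓ′) C 1 ⟩
    2 * suc ℓ′ + (C + 1) ≡⟨ cong (_+_ (2 * suc ℓ′)) (+-comm C 1) ⟩
    2 * suc ℓ′ + suc C   ≤⟨ +-monoʳ-≤ (2 * suc ℓ′) C<d ⟩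
    2 * suc ℓ′ + t * 2   ∎)
    where open ≤-Reasoning

lowerBound : ∀ {n} ℓ C t (F : Family n) → 1 ≤ ℓ → n ≡ 2 * ℓ + C → Shifted F →
  MissingPairOfSum≤ F (2 * ℓ + t * 2 + 1) → LowerBound F ℓ C (t * 2)
lowerBound (suc ℓ′) C t F _ n≡ sh missingPair with t * 2 ≤? C
... | no d≰C = lowerBound-C<d ℓ′ C t F n≡ (≰⇒> d≰C)
... | yes d≤C with m≤n⇒∃[o]m+o≡n d≤C
...   | e , refl = lowerBound-d≤C ℓ′ t e F n≡ sh missingPair

n≡2ℓ+3c : ∀ {n s ℓ c} → n ≡ 2 * s + c → n + ℓ ≡ 3 * s → n ≡ 2 * ℓ + 3 * c
n≡2ℓ+3c {s = s} {ℓ} {c} refl n+ℓ≡3s =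
  trans (cong (λ s → 2 * s + c) (sym c+ℓ≡s)) (identity₂ c ℓ)
  where
  identity₁ : ∀ s c ℓ → 2 * s + (c + ℓ) ≡ 2 * s + c + ℓ
  identity₁ = solve-∀
  identity₂ : ∀ c ℓ → 2 * (c + ℓ) + c ≡ 2 * ℓ + 3 * c
  identity₂ = solve-∀
  identity₃ : ∀ s → 3 * s ≡ 2 * s + s
  identity₃ = solve-∀
  c+ℓ≡s : c + ℓ ≡ s
  c+ℓ≡s = +-cancelˡ-≡ (2 * s) _ _ (trans (identity₁ s c ℓ) (trans n+ℓ≡3s (identity₃ s)))

lemma12 : (n s ℓ c d : ℕ) → 1 ≤ n → 1 ≤ s → 1 ≤ ℓ → 1 ≤ c →
  n ≡ 2 * s + c → n + ℓ ≡ 3 * s → ℓ < s → c < s → 2 ∣ d →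
  (F : Family n) → Shifted F → (∃ λ m → IsD ℓ F m × m ≤ d) →
  let bound = ((+ (4 * ℓ + 3 * c + d) - + 2) ℤ.* (+ (3 * c + 1) - + d))
              ⊓ ((+ (ℓ + 3 * c + 1) - + (d / 2)) ℤ.* (+ (ℓ + 3 * c) - + (d / 2)))
  in (bound ℤ.≤ + (2 * y2 F))
     × (+ (2 * y2 F) ≡ bound →
          ((A : Subset n) → ∣ A ∣ ≡ 2 →
             (F A ≡ true → SubsetOfInit A (2 * ℓ + d ∸ 1))
             × (SubsetOfInit A (2 * ℓ + d ∸ 1) → F A ≡ true))
          ⊎ ((A : Subset n) → ∣ A ∣ ≡ 2 →
             (F A ≡ true → MeetsInit A (ℓ + d / 2 ∸ 1))
             × (MeetsInit A (ℓ + d / 2 ∸ 1) → F A ≡ true)))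
lemma12 n s ℓ c _ _ _ 1≤ℓ _ n≡2s+c n+ℓ≡3s _ _ (divides t refl) F sh (m , (dcond , _) , m≤d) =
  lowerBound ℓ (3 * c) t F 1≤ℓ (n≡2ℓ+3c {s = s} {c = c} n≡2s+c n+ℓ≡3s) sh
    (DCond⇒missingPair {F = F} {t = t} 1≤ℓ m≤d dcond)
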